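{- Let $a,b,e\in\mathbb Z$ with $a\neq 0$ and $e>0$, and let $h_2(j)=aj^2+bj+e$ for $j\in\mathbb Z_{\geq 0}$, where it is assumed that $h_2(j)\geq 0$ for all $j\geq 0$. Put $\alpha=a/e$ and $\beta=b/e$. If $\alpha+\beta<2$ then $\operatorname{hdepth}(h_2)=c(h_2)$. If $\alpha+\beta\geq 2$ then $\operatorname{hdepth}(h_2)\geq 2$.
   Context: $\mathcal H_0$ denotes the set of functions $h:\mathbb Z_{\geq 0}\to\mathbb Z_{\geq 0}$ with $h(0)>0$. For $h\in\mathcal H_0$ and integers $0\leq k\leq d$, set $\beta_k^d(h)=\sum_{j=0}^k(-1)^{k-j}\binom{d-j}{k-j}h(j)$. The Hilbert depth of $h$ is $\operatorname{hdepth}(h)=\max\{d\in\mathbb Z_{\geq 0}\;:\;\beta_k^d(h)\geq 0\text{ for all }0\leq k\leq d\}$. Also $c(h):=\lfloor h(1)/h(0)\rfloor$. -}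

module Defs where

open import Data.Nat as ℕ using (ℕ; zero; suc; NonZero)
open import Data.Nat.DivMod using (_/_)
open import Data.Nat.Combinatorics using (_C_)
open import Data.Integer as ℤ using (ℤ; +_; -_; _+_; _*_; ∣_∣; _≤_)
open import Data.Product using (_×_)

InH₀ : (ℕ → ℕ) → Set
InH₀ h = 0 ℕ.< h 0

sgn : ℕ → ℤ
sgn zero = + 1
sgn (suc n) = - sgn n

sumTo : ℕ → (ℕ → ℤ) → ℤ
sumTo zero f = f 0
sumTo (suc k) f = sumTo k f + f (suc k)

β : ℕ → ℕ → (ℕ → ℕ) → ℤ
β k d h = sumTo k (λ j → sgn (k ℕ.∸ j) * (+ ((d ℕ.∸ j) C (k ℕ.∸ j))) * (+ h j))

Admissible : (ℕ → ℕ) → ℕ → Set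
Admissible h d = ∀ k → k ℕ.≤ d → + 0 ≤ β k d h

IsHdepth : (ℕ → ℕ) → ℕ → Set
IsHdepth h d = Admissible h d × (∀ d' → Admissible h d' → d' ℕ.≤ d)

c : (h : ℕ → ℕ) → .{{NonZero (h 0)}} → ℕ
c h = h 1 / h 0

h₂ℤ : ℤ → ℤ → ℤ → ℕ → ℤ
h₂ℤ a b e j = a * (+ j) * (+ j) + b * (+ j) + e

-- h₂ as an ℕ-valued function (its values are assumed ≥ 0, so ∣_∣ is the identity there)
h₂ : ℤ → ℤ → ℤ → ℕ → ℕ
h₂ a b e j = ∣ h₂ℤ a b e j ∣

-- Admissibility of d at k = 1 says exactly d · h(0) ≤ h(1), so hdepth(h) ≤ c(h) for every h.
-- For h₂ we have h₂(0) = e and h₂(1) = a + b + e, so α + β < 2 means c(h₂) ≤ 2, while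
-- α + β ≥ 2 gives c(h₂) ≥ 2.  The only remaining condition for d = 2 is
-- β₂²(h₂) = h₂(0) − h₂(1) + h₂(2) = 2a + h₂(1) ≥ 0, and a ≥ 0 because h₂ stays nonnegative.
-- Finally hdepth exists because admissibility is decidable and bounded by c(h).
module Submission where

open import Defs
open import Data.Nat as ℕ using (ℕ; zero; suc; z≤n; s≤s; NonZero)
import Data.Nat.Properties as ℕₚ
open import Data.Nat.DivMod using (_/_; m/n*n≤m; m*n/n≡m; /-monoˡ-≤; m<n*o⇒m/o<n)
open import Data.Nat.Combinatorics using (_C_; nC1≡n)
open import Data.Integer using (ℤ; +_; -[1+_]; -_; _+_; _-_; _*_; _<_; _≤_; ∣_∣; +≤+; -≤+; -≤-; -<+)
import Data.Integer.Properties as ℤₚ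
open import Data.Integer.Tactic.RingSolver using (solve-∀)
open import Data.Product using (_×_; _,_; proj₂; ∃-syntax)
open import Data.Empty using (⊥-elim)
open import Function.Bundles using (_⇔_; mk⇔; Equivalence)
open import Relation.Nullary using (¬_; Dec; contradiction)
open import Relation.Nullary.Decidable using (yes; no; map′)
open import Relation.Unary using (Pred; Decidable)
open import Relation.Binary.PropositionalEquality using (_≡_; refl; sym; trans; cong; cong₂; subst; module ≡-Reasoning)

largest : ∀ {p} {P : Pred ℕ p} → Decidable P → ∀ N → (∀ n → P n → n ℕ.≤ N) →
          ∀ {m} → P m → ∃[ d ] (P d × (∀ n → P n → n ℕ.≤ d))
largest P? N bound Pm with P? N
... | yes PN = N , PN , bound
largest {P = P} P? zero bound {m} Pm | no ¬P0 = ⊥-elim (¬P0 (subst P (ℕₚ.n≤0⇒n≡0 (bound m Pm)) Pm))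
largest {P = P} P? (suc N) bound Pm | no ¬PN = largest P? N bound′ Pm
  where
    bound′ : ∀ n → P n → n ℕ.≤ N
    bound′ n Pn = ℕ.s≤s⁻¹ (ℕₚ.≤∧≢⇒< (bound n Pn) λ { refl → ¬PN Pn })

i≤+∣i∣ : ∀ i → i ≤ + ∣ i ∣
i≤+∣i∣ (+ _) = ℤₚ.≤-refl
i≤+∣i∣ -[1+ _ ] = -≤+

module _ (h : ℕ → ℕ) where

  β₀ : ∀ d → β 0 d h ≡ + h 0
  β₀ d = ℤₚ.*-identityˡ (+ h 0)

  β₁ : ∀ d → β 1 d h ≡ + h 1 - + (d ℕ.* h 0)
  β₁ d = begin
    β 1 d h                     ≡⟨ expand (+ (d C 1)) (+ h 0) (+ h 1) ⟩
    + h 1 - + (d C 1) * + h 0   ≡⟨ cong (λ n → + h 1 - + n * + h 0) (nC1≡n d) ⟩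
    + h 1 - + d * + h 0         ≡⟨ cong (_-_ (+ h 1)) (sym (ℤₚ.pos-* d (h 0))) ⟩
    + h 1 - + (d ℕ.* h 0)       ∎
    where
      open ≡-Reasoning
      -- the ring solver only sees through a goal written literally as a polynomial,
      -- so each identity about β or h₂ℤ is first stated on the unfolded term
      expand : ∀ x y z → - + 1 * x * y + + 1 * + 1 * z ≡ z - x * y
      expand = solve-∀

  β₂² : β 2 2 h ≡ + h 0 - + h 1 + + h 2
  β₂² = expand (+ h 0) (+ h 1) (+ h 2)
    where
      expand : ∀ x y z → + 1 * + 1 * x + - + 1 * + 1 * y + + 1 * + 1 * z ≡ x - y + z
      expand = solve-∀

  0≤β₀ : ∀ d → + 0 ≤ β 0 d h
  0≤β₀ d = subst (+ 0 ≤_) (sym (β₀ d)) (+≤+ z≤n)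

  0≤β₁⇔d*h₀≤h₁ : ∀ d → + 0 ≤ β 1 d h ⇔ d ℕ.* h 0 ℕ.≤ h 1
  0≤β₁⇔d*h₀≤h₁ d = mk⇔
    (λ 0≤β → ℤₚ.drop‿+≤+ (ℤₚ.0≤i-j⇒j≤i (subst (+ 0 ≤_) (β₁ d) 0≤β)))
    (λ d*h₀≤h₁ → subst (+ 0 ≤_) (sym (β₁ d)) (ℤₚ.i≤j⇒0≤j-i (+≤+ d*h₀≤h₁)))

  admissible? : ∀ d → Dec (Admissible h d)
  admissible? d = map′ (λ all k k≤d → all (s≤s k≤d)) (λ adm {k} k<1+d → adm k (ℕ.s≤s⁻¹ k<1+d))
    (ℕₚ.allUpTo? (λ k → + 0 ℤₚ.≤? β k d h) (suc d))

  admissible-0 : Admissible h 0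
  admissible-0 zero _ = 0≤β₀ 0
  admissible-0 (suc _) ()

  admissible-1 : 1 ℕ.* h 0 ℕ.≤ h 1 → Admissible h 1
  admissible-1 _ zero _ = 0≤β₀ 1
  admissible-1 h₀≤h₁ (suc zero) _ = Equivalence.from (0≤β₁⇔d*h₀≤h₁ 1) h₀≤h₁
  admissible-1 _ (suc (suc _)) (s≤s ())

  admissible-2 : 2 ℕ.* h 0 ℕ.≤ h 1 → + 0 ≤ + h 0 - + h 1 + + h 2 → Admissible h 2
  admissible-2 _ _ zero _ = 0≤β₀ 2
  admissible-2 2h₀≤h₁ _ (suc zero) _ = Equivalence.from (0≤β₁⇔d*h₀≤h₁ 2) 2h₀≤h₁
  admissible-2 _ 0≤β₂² (suc (suc zero)) _ = subst (+ 0 ≤_) (sym β₂²) 0≤β₂²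
  admissible-2 _ _ (suc (suc (suc _))) (s≤s (s≤s ()))

  module _ .{{_ : NonZero (h 0)}} where

    admissible⇒≤c : ∀ d → Admissible h d → d ℕ.≤ c h
    admissible⇒≤c zero _ = z≤n
    admissible⇒≤c d@(suc _) adm = subst (ℕ._≤ h 1 / h 0) (m*n/n≡m d (h 0))
      (/-monoˡ-≤ (h 0) (Equivalence.to (0≤β₁⇔d*h₀≤h₁ d) (adm 1 (s≤s z≤n))))

    c-isHdepth : c h ℕ.< 3 → + 0 ≤ + h 0 - + h 1 + + h 2 → IsHdepth h (c h)
    c-isHdepth c<3 0≤β₂² = admissible-below-3 (c h) c<3 (m/n*n≤m (h 1) (h 0)) , admissible⇒≤c
      where
        admissible-below-3 : ∀ d → d ℕ.< 3 → d ℕ.* h 0 ℕ.≤ h 1 → Admissible h d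
        admissible-below-3 0 _ _ = admissible-0
        admissible-below-3 1 _ h₀≤h₁ = admissible-1 h₀≤h₁
        admissible-below-3 2 _ 2h₀≤h₁ = admissible-2 2h₀≤h₁ 0≤β₂²
        admissible-below-3 (suc (suc (suc _))) (s≤s (s≤s (s≤s ()))) _

    hdepth-exists : ∀ {m} → Admissible h m → ∃[ d ] (IsHdepth h d × m ℕ.≤ d)
    hdepth-exists {m} adm =
      let d , isHdepth = largest admissible? (c h) admissible⇒≤c adm
      in d , isHdepth , proj₂ isHdepth m adm

h₂ℤ[0]≡e : ∀ a b e → h₂ℤ a b e 0 ≡ e
h₂ℤ[0]≡e = expand
  where
    expand : ∀ a b e → a * + 0 * + 0 + b * + 0 + e ≡ e
    expand = solve-∀

h₂ℤ[1]≡a+b+e : ∀ a b e → h₂ℤ a b e 1 ≡ a + b + e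
h₂ℤ[1]≡a+b+e = expand
  where
    expand : ∀ a b e → a * + 1 * + 1 + b * + 1 + e ≡ a + b + e
    expand = solve-∀

h₂ℤ[0]-h₂ℤ[1]+h₂ℤ[2]≡2a+h₂ℤ[1] : ∀ a b e → h₂ℤ a b e 0 - h₂ℤ a b e 1 + h₂ℤ a b e 2 ≡ a + a + h₂ℤ a b e 1
h₂ℤ[0]-h₂ℤ[1]+h₂ℤ[2]≡2a+h₂ℤ[1] = expand
  where
    expand : ∀ a b e → (a * + 0 * + 0 + b * + 0 + e) - (a * + 1 * + 1 + b * + 1 + e) + (a * + 2 * + 2 + b * + 2 + e)
                       ≡ a + a + (a * + 1 * + 1 + b * + 1 + e)
    expand = solve-∀

-- At j = ∣b∣ + ∣e∣ + 1 the term a j² ≤ − j² outweighs b j + e.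
leading-coefficient-nonneg : ∀ a b e → (∀ j → + 0 ≤ h₂ℤ a b e j) → + 0 ≤ a
leading-coefficient-nonneg (+ _) _ _ _ = +≤+ z≤n
leading-coefficient-nonneg -[1+ m ] b e nonneg = contradiction (nonneg J) (ℤₚ.<⇒≱ h₂ℤ[J]<0)
  where
    open ℤₚ.≤-Reasoning
    B = ∣ b ∣
    E = ∣ e ∣
    J = suc (B ℕ.+ E)
    expand : ∀ x y → - + 1 * (+ 1 + (x + y)) * (+ 1 + (x + y)) + x * (+ 1 + (x + y)) + y
                     ≡ - (+ 1 + (y + + 1) * (x + y))
    expand = solve-∀
    h₂ℤ[J]<0 : h₂ℤ -[1+ m ] b e J < + 0
    h₂ℤ[J]<0 = begin-strict
      -[1+ m ] * + J * + J + b * + J + e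
        ≤⟨ ℤₚ.+-mono-≤ (ℤₚ.+-mono-≤ (ℤₚ.*-monoʳ-≤-nonNeg (+ J) (ℤₚ.*-monoʳ-≤-nonNeg (+ J) (-≤- (z≤n {m}))))
                                   (ℤₚ.*-monoʳ-≤-nonNeg (+ J) (i≤+∣i∣ b)))
                       (i≤+∣i∣ e) ⟩
      - + 1 * + J * + J + + B * + J + + E
        ≡⟨ expand (+ B) (+ E) ⟩
      - (+ 1 + + (E ℕ.+ 1) * + (B ℕ.+ E))
        ≡⟨ cong (λ t → - (+ 1 + t)) (sym (ℤₚ.pos-* (E ℕ.+ 1) (B ℕ.+ E))) ⟩
      -[1+ (E ℕ.+ 1) ℕ.* (B ℕ.+ E) ]
        <⟨ -<+ ⟩
      + 0 ∎

module _ (a b e : ℤ) (nonneg : ∀ j → + 0 ≤ h₂ℤ a b e j) where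

  +h₂≡h₂ℤ : ∀ j → + h₂ a b e j ≡ h₂ℤ a b e j
  +h₂≡h₂ℤ j = ℤₚ.0≤i⇒+∣i∣≡i (nonneg j)

  +h₂[0]≡e : + h₂ a b e 0 ≡ e
  +h₂[0]≡e = trans (+h₂≡h₂ℤ 0) (h₂ℤ[0]≡e a b e)

  +h₂[1]≡a+b+e : + h₂ a b e 1 ≡ a + b + e
  +h₂[1]≡a+b+e = trans (+h₂≡h₂ℤ 1) (h₂ℤ[1]≡a+b+e a b e)

  h₂[0]-nonZero : + 0 < e → NonZero (h₂ a b e 0)
  h₂[0]-nonZero 0<e = ℕ.>-nonZero (ℤₚ.drop‿+<+ (subst (+ 0 <_) (sym +h₂[0]≡e) 0<e))

  0≤h₂[0]-h₂[1]+h₂[2] : + 0 ≤ + h₂ a b e 0 - + h₂ a b e 1 + + h₂ a b e 2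
  0≤h₂[0]-h₂[1]+h₂[2] = begin
    + 0
      ≤⟨ ℤₚ.+-mono-≤ (ℤₚ.+-mono-≤ 0≤a 0≤a) (nonneg 1) ⟩
    a + a + h₂ℤ a b e 1
      ≡⟨ sym (h₂ℤ[0]-h₂ℤ[1]+h₂ℤ[2]≡2a+h₂ℤ[1] a b e) ⟩
    h₂ℤ a b e 0 - h₂ℤ a b e 1 + h₂ℤ a b e 2
      ≡⟨ sym (cong₂ _+_ (cong₂ _-_ (+h₂≡h₂ℤ 0) (+h₂≡h₂ℤ 1)) (+h₂≡h₂ℤ 2)) ⟩
    + h₂ a b e 0 - + h₂ a b e 1 + + h₂ a b e 2 ∎
    where
      open ℤₚ.≤-Reasoning
      0≤a : + 0 ≤ a
      0≤a = leading-coefficient-nonneg a b e nonneg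

  h₂[1]<3*h₂[0] : a + b < + 2 * e → h₂ a b e 1 ℕ.< 3 ℕ.* h₂ a b e 0
  h₂[1]<3*h₂[0] a+b<2e = ℤₚ.drop‿+<+ (begin-strict
    + h₂ a b e 1           ≡⟨ +h₂[1]≡a+b+e ⟩
    a + b + e              <⟨ ℤₚ.+-monoˡ-< e a+b<2e ⟩
    + 2 * e + e            ≡⟨ 2x+x≡3x e ⟩
    + 3 * e                ≡⟨ cong (+ 3 *_) (sym +h₂[0]≡e) ⟩
    + 3 * + h₂ a b e 0     ≡⟨ sym (ℤₚ.pos-* 3 (h₂ a b e 0)) ⟩
    + (3 ℕ.* h₂ a b e 0)   ∎)
    where
      open ℤₚ.≤-Reasoning
      2x+x≡3x : ∀ x → + 2 * x + x ≡ + 3 * x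
      2x+x≡3x = solve-∀

  2*h₂[0]≤h₂[1] : + 2 * e ≤ a + b → 2 ℕ.* h₂ a b e 0 ℕ.≤ h₂ a b e 1
  2*h₂[0]≤h₂[1] 2e≤a+b = ℤₚ.drop‿+≤+ (begin
    + (2 ℕ.* h₂ a b e 0)   ≡⟨ ℤₚ.pos-* 2 (h₂ a b e 0) ⟩
    + 2 * + h₂ a b e 0     ≡⟨ cong (+ 2 *_) +h₂[0]≡e ⟩
    + 2 * e                ≤⟨ 2e≤a+b ⟩
    a + b                  ≤⟨ ℤₚ.i≤i+j (a + b) (+ h₂ a b e 0) ⟩
    a + b + + h₂ a b e 0   ≡⟨ cong (_+_ (a + b)) +h₂[0]≡e ⟩
    a + b + e              ≡⟨ sym +h₂[1]≡a+b+e ⟩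
    + h₂ a b e 1           ∎)
    where open ℤₚ.≤-Reasoning

lemma2p2 : (a b e : ℤ) → ¬ (a ≡ + 0) → + 0 < e → (∀ j → + 0 ≤ h₂ℤ a b e j) →
    (∀ (nz : ℕ.NonZero (h₂ a b e 0)) → a + b < + 2 * e → IsHdepth (h₂ a b e) (c (h₂ a b e) {{nz}}))
    × (+ 2 * e ≤ a + b → ∃[ d ] (IsHdepth (h₂ a b e) d × 2 ℕ.≤ d))
lemma2p2 a b e _ 0<e nonneg = hdepth≡c , 2≤hdepth
  where
    h = h₂ a b e

    hdepth≡c : (nz : NonZero (h 0)) → a + b < + 2 * e → IsHdepth h (c h {{nz}})
    hdepth≡c nz a+b<2e = c-isHdepth h {{nz}}
      (m<n*o⇒m/o<n {{nz}} (h₂[1]<3*h₂[0] a b e nonneg a+b<2e)) (0≤h₂[0]-h₂[1]+h₂[2] a b e nonneg)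

    2≤hdepth : + 2 * e ≤ a + b → ∃[ d ] (IsHdepth h d × 2 ℕ.≤ d)
    2≤hdepth 2e≤a+b = hdepth-exists h {{h₂[0]-nonZero a b e nonneg 0<e}}
      (admissible-2 h (2*h₂[0]≤h₂[1] a b e nonneg 2e≤a+b) (0≤h₂[0]-h₂[1]+h₂[2] a b e nonneg))
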